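{- Let $P$ be a finite poset and $A$ its set of minimal elements. Then for every nonnegative integer $m$, $$e(m,P)=\sum_{B\subseteq A}(-1)^{|B|}\, d(P-B)^m .$$
   Context: For a finite poset $P$ on a set $K$ and a finite set $M$ disjoint from $K$ with $|M|=m$, $e(m,P)$ is the number of partial orders on $M\cup K$ that induce $P$ on $K$ and whose set of minimal elements is exactly $M$ (this depends only on $m$). $d(\cdot)$ denotes the number of downsets of a finite poset (the empty poset has one), and $P-B$ is the subposet induced on $K\setminus B$. Convention $x^0=1$. -}

module Defs where

open import Data.Bool using (Bool; true; false; _∧_; _∨_; not; _xor_; if_then_else_)
open import Data.Nat using (ℕ; zero; suc; _+_)
open import Data.Fin using (Fin; zero; suc; _↑ʳ_; _↑ˡ_; _≟_)
open import Data.List using (List; []; _∷_; concatMap; map)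
open import Data.Integer using (ℤ; +_; -_) renaming (_+_ to _+ℤ_; _*_ to _*ℤ_; _^_ to _^ℤ_)
open import Relation.Nullary.Decidable using (⌊_⌋)

allF : ∀ {n} → (Fin n → Bool) → Bool
allF {zero} f = true
allF {suc n} f = f zero ∧ allF (λ i → f (suc i))

_⇒ᵇ_ : Bool → Bool → Bool
a ⇒ᵇ b = not a ∨ b

_⇔ᵇ_ : Bool → Bool → Bool
a ⇔ᵇ b = not (a xor b)

allFuns : ∀ {A : Set} (n : ℕ) → List A → List (Fin n → A)
allFuns zero xs = (λ ()) ∷ []
allFuns {A} (suc n) xs =
  concatMap (λ a → map (λ f → cons a f) (allFuns n xs)) xs
  where
  cons : A → (Fin n → A) → Fin (suc n) → A
  cons a f zero = a
  cons a f (suc i) = f i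

bools : List Bool
bools = true ∷ false ∷ []

count : ∀ {A : Set} → (A → Bool) → List A → ℕ
count p [] = 0
count p (x ∷ xs) = if p x then suc (count p xs) else count p xs

sumℤ : ∀ {A : Set} → (A → ℤ) → List A → ℤ
sumℤ f [] = + 0
sumℤ f (x ∷ xs) = f x +ℤ sumℤ f xs

-- A binary relation on Fin n (R x y read as x ≤ y) and a subset of Fin n.
Rel : ℕ → Set
Rel n = Fin n → Fin n → Bool

Subset : ℕ → Set
Subset n = Fin n → Bool

allRels : (n : ℕ) → List (Rel n)
allRels n = allFuns n (allFuns n bools)

allSubsets : (n : ℕ) → List (Subset n)
allSubsets n = allFuns n bools

card : ∀ {n} → Subset n → ℕ
card {zero} S = 0
card {suc n} S = (if S zero then 1 else 0) + card (λ i → S (suc i))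

_⊆ᵇ_ : ∀ {n} → Subset n → Subset n → Bool
S ⊆ᵇ T = allF λ x → S x ⇒ᵇ T x

isPartialOrder : ∀ {n} → Rel n → Bool
isPartialOrder R =
  allF λ x → R x x ∧
    allF λ y → ((R x y ∧ R y x) ⇒ᵇ ⌊ x ≟ y ⌋) ∧
      allF λ z → (R x y ∧ R y z) ⇒ᵇ R x z

isMinimal : ∀ {n} → Rel n → Fin n → Bool
isMinimal R x = allF λ y → R y x ⇒ᵇ ⌊ y ≟ x ⌋

minimals : ∀ {n} → Rel n → Subset n
minimals R = isMinimal R

-- e(m,P): ground set M ∪ K is Fin (m + k), with M = (Fin m) ↑ˡ k
-- and K = m ↑ʳ (Fin k).  Count partial orders R on it inducing P on K
-- whose minimal elements are exactly M.
isExtension : (m : ℕ) {k : ℕ} → Rel k → Rel (m + k) → Bool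
isExtension m {k} P R =
  isPartialOrder R ∧
  (allF λ i → allF λ j → R (m ↑ʳ i) (m ↑ʳ j) ⇔ᵇ P i j) ∧
  (allF λ (i : Fin m) → isMinimal R (i ↑ˡ k)) ∧
  (allF λ (j : Fin k) → not (isMinimal R (m ↑ʳ j)))

e : (m : ℕ) {k : ℕ} → Rel k → ℕ
e m {k} P = count (isExtension m P) (allRels (m + k))

isDownsetOn : ∀ {k} → Rel k → Subset k → Subset k → Bool
isDownsetOn P C S =
  (S ⊆ᵇ C) ∧ (allF λ x → allF λ y → (C x ∧ S y ∧ P x y) ⇒ᵇ S x)

dOn : ∀ {k} → Rel k → Subset k → ℕ
dOn {k} P C = count (isDownsetOn P C) (allSubsets k)

compl : ∀ {k} → Subset k → Subset k
compl B x = not (B x)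

dMinus : ∀ {k} → Rel k → Subset k → ℕ
dMinus P B = dOn P (compl B)

rhs : (m : ℕ) {k : ℕ} → Rel k → ℤ
rhs m {k} P =
  sumℤ (λ B → if B ⊆ᵇ minimals P
                 then ((- (+ 1)) ^ℤ card B) *ℤ ((+ dMinus P B) ^ℤ m)
                 else + 0)
       (allSubsets k)

-- An extension of P by new minimal elements M is determined by the upsets g i ⊆ K of elements
-- lying above each i ∈ M, and the elements of K are non-minimal exactly when every minimal
-- element of P lies in some g i. Inclusion–exclusion over the set B of minimal elements left
-- uncovered counts these covering families as Σ_B (−1)^|B| u(B)^m, where u(B) is the number of
-- upsets of P disjoint from B; complementation inside K ∖ B matches those upsets with the
-- downsets of P − B, so u(B) = d(P − B).

module Submission where

open import Defs
open import Algebra.Bundles using (CommutativeMonoid)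
open import Algebra.Properties.CommutativeSemigroup using (interchange; x∙yz≈y∙xz)
open import Data.Bool using (Bool; true; false; _∧_; _∨_; not; if_then_else_)
open import Data.Bool.Properties using (¬-not; ⇔→≡; ∨-zeroʳ; ∧-commutativeMonoid)
open import Data.Empty using (⊥; ⊥-elim)
open import Data.Fin using (Fin; zero; suc; _≟_; _↑ˡ_; _↑ʳ_; splitAt; join)
import Data.Fin.Properties as Fin
open import Data.Integer using (ℤ; +_; 0ℤ; 1ℤ; -1ℤ)
  renaming (_+_ to _+ℤ_; _*_ to _*ℤ_; _^_ to _^ℤ_)
import Data.Integer.Properties as ℤ
open import Data.List using (List; []; _∷_; concatMap; map; _++_)
open import Data.Nat using (ℕ; zero; suc; _<_; _≤_; z≤n; s≤s; _+_)
import Data.Nat.Properties as ℕ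
open import Data.Nat.Induction using (<-wellFounded)
open import Data.Product using (∃; _×_; _,_; proj₁; proj₂)
open import Data.Sum using (_⊎_; inj₁; inj₂)
open import Function.Bundles using (mk⇔)
open import Induction.WellFounded using (Acc; acc)
open import Relation.Binary.PropositionalEquality
  using (_≡_; refl; sym; trans; cong; cong₂; subst; module ≡-Reasoning)
open import Relation.Nullary using (yes; no)
open import Relation.Nullary.Decidable using (⌊_⌋)

∧-elimˡ : ∀ {a b} → a ∧ b ≡ true → a ≡ true
∧-elimˡ {true} _ = refl

∧-elimʳ : ∀ {a b} → a ∧ b ≡ true → b ≡ true
∧-elimʳ {true} h = h

∧-intro : ∀ {a b} → a ≡ true → b ≡ true → a ∧ b ≡ true
∧-intro refl refl = refl

⇒ᵇ-elim : ∀ {a b} → (a ⇒ᵇ b) ≡ true → a ≡ true → b ≡ true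
⇒ᵇ-elim h refl = h

⇒ᵇ-intro : ∀ {a b} → (a ≡ true → b ≡ true) → (a ⇒ᵇ b) ≡ true
⇒ᵇ-intro {true} f = f refl
⇒ᵇ-intro {false} _ = refl

⇔ᵇ-elim : ∀ {a b} → (a ⇔ᵇ b) ≡ true → a ≡ b
⇔ᵇ-elim {true} {true} _ = refl
⇔ᵇ-elim {false} {false} _ = refl

⇔ᵇ-intro : ∀ {a b} → a ≡ b → (a ⇔ᵇ b) ≡ true
⇔ᵇ-intro {true} refl = refl
⇔ᵇ-intro {false} refl = refl

not-true : ∀ {a} → not a ≡ true → a ≡ false
not-true {false} _ = refl

not-false : ∀ {a} → not a ≡ false → a ≡ true
not-false {true} _ = refl

true≢false : ∀ {a} → a ≡ true → a ≡ false → ⊥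
true≢false refl ()

≢true⇒≡false : ∀ {a} → (a ≡ true → ⊥) → a ≡ false
≢true⇒≡false = ¬-not

bool-ext : ∀ {a b} → (a ≡ true → b ≡ true) → (b ≡ true → a ≡ true) → a ≡ b
bool-ext f g = ⇔→≡ (mk⇔ f g)

≟-elim : ∀ {n} {x y : Fin n} → ⌊ x ≟ y ⌋ ≡ true → x ≡ y
≟-elim {x = x} {y} h with x ≟ y
... | yes x≡y = x≡y

≟-intro : ∀ {n} {x y : Fin n} → x ≡ y → ⌊ x ≟ y ⌋ ≡ true
≟-intro {x = x} {y} x≡y with x ≟ y
... | yes _ = refl
... | no x≢y = ⊥-elim (x≢y x≡y)

allF-cong : ∀ {n} {f g : Fin n → Bool} → (∀ i → f i ≡ g i) → allF f ≡ allF g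
allF-cong {zero} _ = refl
allF-cong {suc n} h = cong₂ _∧_ (h zero) (allF-cong (λ i → h (suc i)))

allF-elim : ∀ {n} {f : Fin n → Bool} → allF f ≡ true → ∀ i → f i ≡ true
allF-elim {suc n} h zero = ∧-elimˡ h
allF-elim {suc n} {f} h (suc i) = allF-elim (∧-elimʳ {f zero} h) i

allF-intro : ∀ {n} {f : Fin n → Bool} → (∀ i → f i ≡ true) → allF f ≡ true
allF-intro {zero} _ = refl
allF-intro {suc n} h = ∧-intro (h zero) (allF-intro (λ i → h (suc i)))

allF-false : ∀ {n} {f : Fin n → Bool} → allF f ≡ false → ∃ λ i → f i ≡ false
allF-false {suc n} {f} h with f zero in f0
... | false = zero , f0
... | true with allF-false h
...   | i , fi = suc i , fi

allF-counterexample : ∀ {n} {f : Fin n → Bool} (i : Fin n) → f i ≡ false → allF f ≡ false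
allF-counterexample i fi = ≢true⇒≡false (λ h → true≢false (allF-elim h i) fi)

𝟙 : Bool → ℤ
𝟙 b = if b then 1ℤ else 0ℤ

𝟙-∧ : ∀ a b → 𝟙 (a ∧ b) ≡ 𝟙 a *ℤ 𝟙 b
𝟙-∧ true b = sym (ℤ.*-identityˡ (𝟙 b))
𝟙-∧ false b = refl

if-𝟙 : ∀ c (z : ℤ) → (if c then z else 0ℤ) ≡ 𝟙 c *ℤ z
if-𝟙 true z = sym (ℤ.*-identityˡ z)
if-𝟙 false z = refl

module _ {A : Set} where

  sumℤ-cong : {f g : A → ℤ} → (∀ x → f x ≡ g x) → (xs : List A) → sumℤ f xs ≡ sumℤ g xs
  sumℤ-cong h [] = refl
  sumℤ-cong h (x ∷ xs) = cong₂ _+ℤ_ (h x) (sumℤ-cong h xs)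

  sumℤ-++ : (f : A → ℤ) (xs ys : List A) → sumℤ f (xs ++ ys) ≡ sumℤ f xs +ℤ sumℤ f ys
  sumℤ-++ f [] ys = sym (ℤ.+-identityˡ _)
  sumℤ-++ f (x ∷ xs) ys = trans (cong (f x +ℤ_) (sumℤ-++ f xs ys)) (sym (ℤ.+-assoc (f x) _ _))

  sumℤ-zero : (xs : List A) → sumℤ (λ _ → 0ℤ) xs ≡ 0ℤ
  sumℤ-zero [] = refl
  sumℤ-zero (x ∷ xs) = trans (ℤ.+-identityˡ _) (sumℤ-zero xs)

  sumℤ-+ : (f g : A → ℤ) (xs : List A) → sumℤ (λ x → f x +ℤ g x) xs ≡ sumℤ f xs +ℤ sumℤ g xs
  sumℤ-+ f g [] = refl
  sumℤ-+ f g (x ∷ xs) =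
    trans (cong (f x +ℤ g x +ℤ_) (sumℤ-+ f g xs))
          (interchange ℤ.+-commutativeSemigroup (f x) (g x) _ _)

  sumℤ-*ˡ : (c : ℤ) (f : A → ℤ) (xs : List A) → sumℤ (λ x → c *ℤ f x) xs ≡ c *ℤ sumℤ f xs
  sumℤ-*ˡ c f [] = sym (ℤ.*-zeroʳ c)
  sumℤ-*ˡ c f (x ∷ xs) =
    trans (cong (c *ℤ f x +ℤ_) (sumℤ-*ˡ c f xs)) (sym (ℤ.*-distribˡ-+ c (f x) _))

  sumℤ-*ʳ : (c : ℤ) (f : A → ℤ) (xs : List A) → sumℤ (λ x → f x *ℤ c) xs ≡ sumℤ f xs *ℤ c
  sumℤ-*ʳ c f xs =
    trans (sumℤ-cong (λ x → ℤ.*-comm (f x) c) xs) (trans (sumℤ-*ˡ c f xs) (ℤ.*-comm c _))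

  count-sumℤ : (p : A → Bool) (xs : List A) → + count p xs ≡ sumℤ (λ x → 𝟙 (p x)) xs
  count-sumℤ p [] = refl
  count-sumℤ p (x ∷ xs) with p x
  ... | true = trans (ℤ.pos-+ 1 (count p xs)) (cong (1ℤ +ℤ_) (count-sumℤ p xs))
  ... | false = trans (count-sumℤ p xs) (sym (ℤ.+-identityˡ _))

module _ {A B : Set} where

  sumℤ-concatMap : (f : B → ℤ) (g : A → List B) (xs : List A) →
    sumℤ f (concatMap g xs) ≡ sumℤ (λ x → sumℤ f (g x)) xs
  sumℤ-concatMap f g [] = refl
  sumℤ-concatMap f g (x ∷ xs) =
    trans (sumℤ-++ f (g x) (concatMap g xs)) (cong (sumℤ f (g x) +ℤ_) (sumℤ-concatMap f g xs))

  sumℤ-map : (f : B → ℤ) (g : A → B) (xs : List A) → sumℤ f (map g xs) ≡ sumℤ (λ x → f (g x)) xs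
  sumℤ-map f g [] = refl
  sumℤ-map f g (x ∷ xs) = cong (f (g x) +ℤ_) (sumℤ-map f g xs)

  sumℤ-comm : (F : A → B → ℤ) (xs : List A) (ys : List B) →
    sumℤ (λ x → sumℤ (F x) ys) xs ≡ sumℤ (λ y → sumℤ (λ x → F x y) xs) ys
  sumℤ-comm F [] ys = sym (sumℤ-zero ys)
  sumℤ-comm F (x ∷ xs) ys =
    trans (cong (sumℤ (F x) ys +ℤ_) (sumℤ-comm F xs ys)) (sym (sumℤ-+ (F x) _ ys))

prodFin : ∀ {n} → (Fin n → ℤ) → ℤ
prodFin {zero} f = 1ℤ
prodFin {suc n} f = f zero *ℤ prodFin (λ i → f (suc i))

prodFin-cong : ∀ {n} {f g : Fin n → ℤ} → (∀ i → f i ≡ g i) → prodFin f ≡ prodFin g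
prodFin-cong {zero} h = refl
prodFin-cong {suc n} h = cong₂ _*ℤ_ (h zero) (prodFin-cong (λ i → h (suc i)))

prodFin-* : ∀ {n} (f g : Fin n → ℤ) → prodFin (λ i → f i *ℤ g i) ≡ prodFin f *ℤ prodFin g
prodFin-* {zero} f g = refl
prodFin-* {suc n} f g =
  trans (cong (f zero *ℤ g zero *ℤ_) (prodFin-* (λ i → f (suc i)) (λ i → g (suc i))))
        (interchange ℤ.*-commutativeSemigroup (f zero) (g zero) _ _)

prodFin-const : ∀ n (c : ℤ) → prodFin {n} (λ _ → c) ≡ c ^ℤ n
prodFin-const zero c = refl
prodFin-const (suc n) c = cong (c *ℤ_) (prodFin-const n c)

𝟙-allF : ∀ {n} (f : Fin n → Bool) → 𝟙 (allF f) ≡ prodFin (λ i → 𝟙 (f i))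
𝟙-allF {zero} f = refl
𝟙-allF {suc n} f = trans (𝟙-∧ (f zero) _) (cong (𝟙 (f zero) *ℤ_) (𝟙-allF (λ i → f (suc i))))

sumℤ-allFuns-prodFin : ∀ {A : Set} n (xs : List A) (t : Fin n → A → ℤ) →
  sumℤ (λ g → prodFin (λ i → t i (g i))) (allFuns n xs) ≡ prodFin (λ i → sumℤ (t i) xs)
sumℤ-allFuns-prodFin zero xs t = refl
sumℤ-allFuns-prodFin (suc n) xs t =
  begin
    sumℤ (λ g → prodFin (λ i → t i (g i))) (allFuns (suc n) xs)
  ≡⟨ trans (sumℤ-concatMap _ _ xs) (sumℤ-cong (λ a → sumℤ-map _ _ (allFuns n xs)) xs) ⟩
    sumℤ (λ a → sumℤ (λ f → t zero a *ℤ prodFin (λ i → t (suc i) (f i))) (allFuns n xs)) xs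
  ≡⟨ sumℤ-cong (λ a → sumℤ-*ˡ (t zero a) _ (allFuns n xs)) xs ⟩
    sumℤ (λ a → t zero a *ℤ sumℤ (λ f → prodFin (λ i → t (suc i) (f i))) (allFuns n xs)) xs
  ≡⟨ sumℤ-cong (λ a → cong (t zero a *ℤ_) (sumℤ-allFuns-prodFin n xs (λ i → t (suc i)))) xs ⟩
    sumℤ (λ a → t zero a *ℤ prodFin (λ i → sumℤ (t (suc i)) xs)) xs
  ≡⟨ sumℤ-*ʳ _ (t zero) xs ⟩
    prodFin (λ i → sumℤ (t i) xs)
  ∎
  where open ≡-Reasoning

sumℤ-allFuns-power : ∀ {A : Set} n (xs : List A) (f : A → ℤ) →
  sumℤ (λ g → prodFin (λ i → f (g i))) (allFuns n xs) ≡ sumℤ f xs ^ℤ n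
sumℤ-allFuns-power n xs f =
  trans (sumℤ-allFuns-prodFin n xs (λ _ → f)) (prodFin-const n (sumℤ f xs))

record Enumeration (A : Set) : Set where
  field
    elems : List A
    eqᵇ : A → A → Bool
    eqᵇ-sym : ∀ x y → eqᵇ x y ≡ eqᵇ y x
    eqᵇ-unique : ∀ x → sumℤ (λ y → 𝟙 (eqᵇ x y)) elems ≡ 1ℤ

open Enumeration

boolEnumeration : Enumeration Bool
boolEnumeration .elems = bools
boolEnumeration .eqᵇ = _⇔ᵇ_
boolEnumeration .eqᵇ-sym true true = refl
boolEnumeration .eqᵇ-sym true false = refl
boolEnumeration .eqᵇ-sym false true = refl
boolEnumeration .eqᵇ-sym false false = refl
boolEnumeration .eqᵇ-unique true = refl
boolEnumeration .eqᵇ-unique false = refl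

funEnumeration : ∀ {A : Set} n → Enumeration A → Enumeration (Fin n → A)
funEnumeration n E .elems = allFuns n (elems E)
funEnumeration n E .eqᵇ f g = allF (λ i → eqᵇ E (f i) (g i))
funEnumeration n E .eqᵇ-sym f g = allF-cong (λ i → eqᵇ-sym E (f i) (g i))
funEnumeration n E .eqᵇ-unique f =
  begin
    sumℤ (λ g → 𝟙 (allF (λ i → eqᵇ E (f i) (g i)))) (allFuns n (elems E))
  ≡⟨ sumℤ-cong (λ g → 𝟙-allF (λ i → eqᵇ E (f i) (g i))) (allFuns n (elems E)) ⟩
    sumℤ (λ g → prodFin (λ i → 𝟙 (eqᵇ E (f i) (g i)))) (allFuns n (elems E))
  ≡⟨ sumℤ-allFuns-prodFin n (elems E) (λ i a → 𝟙 (eqᵇ E (f i) a)) ⟩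
    prodFin (λ i → sumℤ (λ a → 𝟙 (eqᵇ E (f i) a)) (elems E))
  ≡⟨ prodFin-cong (λ i → eqᵇ-unique E (f i)) ⟩
    prodFin {n} (λ _ → 1ℤ)
  ≡⟨ trans (prodFin-const n 1ℤ) (ℤ.^-zeroˡ n) ⟩
    1ℤ
  ∎
  where open ≡-Reasoning

-- The last hypothesis says that φ and ψ restrict to mutually inverse bijections between
-- the elements satisfying p and those satisfying q.
count-bijection : ∀ {A B : Set} (EA : Enumeration A) (EB : Enumeration B)
  (p : A → Bool) (q : B → Bool) (φ : A → B) (ψ : B → A) →
  (∀ x y → (p x ∧ eqᵇ EB (φ x) y) ≡ (q y ∧ eqᵇ EA x (ψ y))) →
  count p (elems EA) ≡ count q (elems EB)
count-bijection EA EB p q φ ψ graph = ℤ.+-injective (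
  begin
    + count p (elems EA)
  ≡⟨ count-sumℤ p (elems EA) ⟩
    sumℤ (λ x → 𝟙 (p x)) (elems EA)
  ≡⟨ sumℤ-cong (λ x → sym (sumℤ-𝟙-∧-unique (elems EB) (p x) (eqᵇ EB (φ x))
                                             (eqᵇ-unique EB (φ x)))) (elems EA) ⟩
    sumℤ (λ x → sumℤ (λ y → 𝟙 (p x ∧ eqᵇ EB (φ x) y)) (elems EB)) (elems EA)
  ≡⟨ sumℤ-cong (λ x → sumℤ-cong (λ y → cong 𝟙 (graph x y)) (elems EB)) (elems EA) ⟩
    sumℤ (λ x → sumℤ (λ y → 𝟙 (q y ∧ eqᵇ EA x (ψ y))) (elems EB)) (elems EA)
  ≡⟨ sumℤ-comm _ (elems EA) (elems EB) ⟩
    sumℤ (λ y → sumℤ (λ x → 𝟙 (q y ∧ eqᵇ EA x (ψ y))) (elems EA)) (elems EB)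
  ≡⟨ sumℤ-cong (λ y → sumℤ-𝟙-∧-unique (elems EA) (q y) (λ x → eqᵇ EA x (ψ y))
                                        (eqᵇ-unique-flipped EA (ψ y))) (elems EB) ⟩
    sumℤ (λ y → 𝟙 (q y)) (elems EB)
  ≡⟨ sym (count-sumℤ q (elems EB)) ⟩
    + count q (elems EB)
  ∎)
  where
  open ≡-Reasoning
  sumℤ-𝟙-∧-unique : ∀ {C : Set} (xs : List C) b (r : C → Bool) →
    sumℤ (λ z → 𝟙 (r z)) xs ≡ 1ℤ → sumℤ (λ z → 𝟙 (b ∧ r z)) xs ≡ 𝟙 b
  sumℤ-𝟙-∧-unique xs b r one = begin
      sumℤ (λ z → 𝟙 (b ∧ r z)) xs       ≡⟨ sumℤ-cong (λ z → 𝟙-∧ b (r z)) xs ⟩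
      sumℤ (λ z → 𝟙 b *ℤ 𝟙 (r z)) xs    ≡⟨ sumℤ-*ˡ (𝟙 b) _ xs ⟩
      𝟙 b *ℤ sumℤ (λ z → 𝟙 (r z)) xs    ≡⟨ cong (𝟙 b *ℤ_) one ⟩
      𝟙 b *ℤ 1ℤ                         ≡⟨ ℤ.*-identityʳ (𝟙 b) ⟩
      𝟙 b                               ∎
  eqᵇ-unique-flipped : ∀ {C : Set} (E : Enumeration C) y →
    sumℤ (λ x → 𝟙 (eqᵇ E x y)) (elems E) ≡ 1ℤ
  eqᵇ-unique-flipped E y =
    trans (sumℤ-cong (λ x → cong 𝟙 (eqᵇ-sym E x y)) (elems E)) (eqᵇ-unique E y)

-- Inclusion–exclusion

sign-card : ∀ {k} (B : Subset k) → -1ℤ ^ℤ card B ≡ prodFin (λ x → if B x then -1ℤ else 1ℤ)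
sign-card {zero} B = refl
sign-card {suc k} B =
  trans (ℤ.^-distribˡ-+-* -1ℤ (if B zero then 1 else 0) (card (λ i → B (suc i))))
        (cong₂ _*ℤ_ (head-sign (B zero)) (sign-card (λ i → B (suc i))))
  where
  head-sign : ∀ b → -1ℤ ^ℤ (if b then 1 else 0) ≡ (if b then -1ℤ else 1ℤ)
  head-sign true = refl
  head-sign false = refl

inclusion-exclusion : ∀ {k} (A N : Subset k) →
  𝟙 (allF λ x → A x ⇒ᵇ not (N x)) ≡
  sumℤ (λ B → if B ⊆ᵇ A then -1ℤ ^ℤ card B *ℤ 𝟙 (B ⊆ᵇ N) else 0ℤ) (allSubsets k)
inclusion-exclusion {k} A N =
  begin
    𝟙 (allF λ x → A x ⇒ᵇ not (N x))
  ≡⟨ 𝟙-allF (λ x → A x ⇒ᵇ not (N x)) ⟩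
    prodFin (λ x → 𝟙 (A x ⇒ᵇ not (N x)))
  ≡⟨ prodFin-cong (λ x → implication-split (A x) (N x)) ⟩
    prodFin (λ x → sumℤ (t x) bools)
  ≡⟨ sym (sumℤ-allFuns-prodFin k bools t) ⟩
    sumℤ (λ B → prodFin (λ x → t x (B x))) (allSubsets k)
  ≡⟨ sumℤ-cong (λ B → sym (summand-as-product B)) (allSubsets k) ⟩
    sumℤ (λ B → if B ⊆ᵇ A then -1ℤ ^ℤ card B *ℤ 𝟙 (B ⊆ᵇ N) else 0ℤ) (allSubsets k)
  ∎
  where
  open ≡-Reasoning
  sign : Bool → ℤ
  sign b = if b then -1ℤ else 1ℤ

  -- 𝟙 (A x ⇒ᵇ not (N x)) = t x true + t x false, and expanding the product of these over x
  -- yields the sum over B.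
  t : Fin k → Bool → ℤ
  t x b = 𝟙 (b ⇒ᵇ A x) *ℤ (sign b *ℤ 𝟙 (b ⇒ᵇ N x))

  implication-split : ∀ a n → 𝟙 (a ⇒ᵇ not n) ≡
    𝟙 (true ⇒ᵇ a) *ℤ (-1ℤ *ℤ 𝟙 (true ⇒ᵇ n))
      +ℤ (𝟙 (false ⇒ᵇ a) *ℤ (1ℤ *ℤ 𝟙 (false ⇒ᵇ n)) +ℤ 0ℤ)
  implication-split true true = refl
  implication-split true false = refl
  implication-split false true = refl
  implication-split false false = refl

  summand-as-product : ∀ B →
    (if B ⊆ᵇ A then -1ℤ ^ℤ card B *ℤ 𝟙 (B ⊆ᵇ N) else 0ℤ) ≡ prodFin (λ x → t x (B x))
  summand-as-product B =
    begin
      (if B ⊆ᵇ A then -1ℤ ^ℤ card B *ℤ 𝟙 (B ⊆ᵇ N) else 0ℤ)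
    ≡⟨ if-𝟙 (B ⊆ᵇ A) _ ⟩
      𝟙 (B ⊆ᵇ A) *ℤ (-1ℤ ^ℤ card B *ℤ 𝟙 (B ⊆ᵇ N))
    ≡⟨ cong₂ _*ℤ_ (𝟙-allF (λ x → B x ⇒ᵇ A x))
                  (cong₂ _*ℤ_ (sign-card B) (𝟙-allF (λ x → B x ⇒ᵇ N x))) ⟩
      prodFin (λ x → 𝟙 (B x ⇒ᵇ A x)) *ℤ
        (prodFin (λ x → sign (B x)) *ℤ prodFin (λ x → 𝟙 (B x ⇒ᵇ N x)))
    ≡⟨ cong (prodFin (λ x → 𝟙 (B x ⇒ᵇ A x)) *ℤ_)
            (sym (prodFin-* (λ x → sign (B x)) (λ x → 𝟙 (B x ⇒ᵇ N x)))) ⟩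
      prodFin (λ x → 𝟙 (B x ⇒ᵇ A x)) *ℤ prodFin (λ x → sign (B x) *ℤ 𝟙 (B x ⇒ᵇ N x))
    ≡⟨ sym (prodFin-* (λ x → 𝟙 (B x ⇒ᵇ A x)) (λ x → sign (B x) *ℤ 𝟙 (B x ⇒ᵇ N x))) ⟩
      prodFin (λ x → t x (B x))
    ∎

record PartialOrderLaws {A : Set} (R : A → A → Bool) : Set where
  field
    reflexive : ∀ x → R x x ≡ true
    antisym : ∀ x y → R x y ≡ true → R y x ≡ true → x ≡ y
    transitive : ∀ x y z → R x y ≡ true → R y z ≡ true → R x z ≡ true

open PartialOrderLaws

isPartialOrder-sound : ∀ {n} (R : Rel n) → isPartialOrder R ≡ true → PartialOrderLaws R
isPartialOrder-sound R h .reflexive x = ∧-elimˡ (allF-elim h x)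
isPartialOrder-sound R h .antisym x y r s =
  ≟-elim (⇒ᵇ-elim (∧-elimˡ (allF-elim (∧-elimʳ (allF-elim h x)) y)) (∧-intro r s))
isPartialOrder-sound R h .transitive x y z r s =
  ⇒ᵇ-elim (allF-elim (∧-elimʳ (allF-elim (∧-elimʳ (allF-elim h x)) y)) z) (∧-intro r s)

isPartialOrder-complete : ∀ {n} (R : Rel n) → PartialOrderLaws R → isPartialOrder R ≡ true
isPartialOrder-complete R po = allF-intro λ x → ∧-intro (reflexive po x) (allF-intro λ y →
  ∧-intro (⇒ᵇ-intro λ h → ≟-intro (antisym po x y (∧-elimˡ h) (∧-elimʳ h)))
          (allF-intro λ z → ⇒ᵇ-intro λ h → transitive po x y z (∧-elimˡ h) (∧-elimʳ h)))

partialOrder-resp : ∀ {A : Set} {R S : A → A → Bool} →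
  (∀ x y → R x y ≡ S x y) → PartialOrderLaws S → PartialOrderLaws R
partialOrder-resp R≗S po .reflexive x = trans (R≗S x x) (reflexive po x)
partialOrder-resp R≗S po .antisym x y r s =
  antisym po x y (trans (sym (R≗S x y)) r) (trans (sym (R≗S y x)) s)
partialOrder-resp R≗S po .transitive x y z r s =
  trans (R≗S x z) (transitive po x y z (trans (sym (R≗S x y)) r) (trans (sym (R≗S y z)) s))

isMinimal-elim : ∀ {n} (R : Rel n) x → isMinimal R x ≡ true → ∀ y → R y x ≡ true → y ≡ x
isMinimal-elim R x h y r = ≟-elim (⇒ᵇ-elim (allF-elim h y) r)

isMinimal-intro : ∀ {n} (R : Rel n) x → (∀ y → R y x ≡ true → y ≡ x) → isMinimal R x ≡ true
isMinimal-intro R x h = allF-intro λ y → ⇒ᵇ-intro λ r → ≟-intro (h y r)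

nonMinimal-elim : ∀ {n} (R : Rel n) x → isMinimal R x ≡ false →
  ∃ λ y → R y x ≡ true × (y ≡ x → ⊥)
nonMinimal-elim R x h with allF-false h
... | y , e with R y x in r
...   | true = y , r , λ y≡x → true≢false (≟-intro y≡x) e

nonMinimal-intro : ∀ {n} (R : Rel n) x y → R y x ≡ true → (y ≡ x → ⊥) → isMinimal R x ≡ false
nonMinimal-intro R x y r y≢x =
  ≢true⇒≡false λ h → y≢x (isMinimal-elim R x h y r)

bit-mono : ∀ {a b} → (a ≡ true → b ≡ true) → (if a then 1 else 0) ≤ (if b then 1 else 0)
bit-mono {false} _ = z≤n
bit-mono {true} h rewrite h refl = s≤s z≤n

card-mono : ∀ {n} (S T : Subset n) → (∀ z → S z ≡ true → T z ≡ true) → card S ≤ card T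
card-mono {zero} S T S⊆T = z≤n
card-mono {suc n} S T S⊆T =
  ℕ.+-mono-≤ (bit-mono (S⊆T zero)) (card-mono _ _ (λ z → S⊆T (suc z)))

card-strict : ∀ {n} (S T : Subset n) → (∀ z → S z ≡ true → T z ≡ true) →
  ∀ w → S w ≡ false → T w ≡ true → card S < card T
card-strict {suc n} S T S⊆T zero Sw Tw rewrite Sw | Tw =
  s≤s (card-mono _ _ (λ z → S⊆T (suc z)))
card-strict {suc n} S T S⊆T (suc w) Sw Tw =
  ℕ.+-mono-≤-< (bit-mono (S⊆T zero)) (card-strict _ _ (λ z → S⊆T (suc z)) w Sw Tw)

minimal-below : ∀ {n} (P : Rel n) → PartialOrderLaws P → ∀ x →
  ∃ λ a → isMinimal P a ≡ true × P a x ≡ true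
minimal-below {n} P po x = go x (<-wellFounded _)
  where
  below : Fin n → Subset n
  below x z = P z x

  fewer-below : ∀ {x y} → P y x ≡ true → (y ≡ x → ⊥) → card (below y) < card (below x)
  fewer-below {x} {y} y≤x y≢x = card-strict _ _ (λ z z≤y → transitive po z y x z≤y y≤x) x
    (≢true⇒≡false λ x≤y → y≢x (antisym po y x y≤x x≤y)) (reflexive po x)

  go : ∀ x → Acc _<_ (card (below x)) → ∃ λ a → isMinimal P a ≡ true × P a x ≡ true
  go x (acc rec) with isMinimal P x in min
  ... | true = x , min , reflexive po x
  ... | false with nonMinimal-elim P x min
  ...   | y , y≤x , y≢x with go y (rec (fewer-below y≤x y≢x))
  ...     | a , min-a , a≤y = a , min-a , transitive po a y x a≤y y≤x

-- Extensions of P by new minimal elements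

isUpset : ∀ {k} → Rel k → Subset k → Bool
isUpset P U = allF λ x → allF λ y → (U x ∧ P x y) ⇒ᵇ U y

uncovered : ∀ {m k} → (Fin m → Subset k) → Subset k
uncovered g x = allF λ i → not (g i x)

allUpsets : ∀ {m k} → Rel k → (Fin m → Subset k) → Bool
allUpsets P g = allF λ i → isUpset P (g i)

isUpsetCover : ∀ {m k} → Rel k → (Fin m → Subset k) → Bool
isUpsetCover P g = allUpsets P g ∧ (allF λ a → isMinimal P a ⇒ᵇ not (uncovered g a))

data Split (m k : ℕ) : Fin (m + k) → Set where
  inM : (i : Fin m) → Split m k (i ↑ˡ k)
  inK : (j : Fin k) → Split m k (m ↑ʳ j)

split : ∀ m k x → Split m k x
split zero k x = inK x
split (suc m) k zero = inM zero
split (suc m) k (suc x) with split m k x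
... | inM i = inM (suc i)
... | inK j = inK j

↑ˡ≢↑ʳ : ∀ {m k} (i : Fin m) (j : Fin k) → i ↑ˡ k ≡ m ↑ʳ j → ⊥
↑ˡ≢↑ʳ {m} {k} i j eq
  with trans (sym (Fin.splitAt-↑ˡ m i k)) (trans (cong (splitAt m) eq) (Fin.splitAt-↑ʳ m k j))
... | ()

module Extensions {m k : ℕ} (P : Rel k) (poP : PartialOrderLaws P) where

  joinRel : (Fin m → Subset k) → Fin m ⊎ Fin k → Fin m ⊎ Fin k → Bool
  joinRel g (inj₁ i) (inj₁ i') = ⌊ i ≟ i' ⌋
  joinRel g (inj₁ i) (inj₂ j) = g i j
  joinRel g (inj₂ j) (inj₁ i) = false
  joinRel g (inj₂ j) (inj₂ j') = P j j'

  extensionBy : (Fin m → Subset k) → Rel (m + k)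
  extensionBy g x y = joinRel g (splitAt m x) (splitAt m y)

  upsetsAbove : Rel (m + k) → Fin m → Subset k
  upsetsAbove R i j = R (i ↑ˡ k) (m ↑ʳ j)

  module _ (g : Fin m → Subset k) where

    extensionBy-MM : ∀ i i' → extensionBy g (i ↑ˡ k) (i' ↑ˡ k) ≡ ⌊ i ≟ i' ⌋
    extensionBy-MM i i' rewrite Fin.splitAt-↑ˡ m i k | Fin.splitAt-↑ˡ m i' k = refl

    extensionBy-MK : ∀ i j → extensionBy g (i ↑ˡ k) (m ↑ʳ j) ≡ g i j
    extensionBy-MK i j rewrite Fin.splitAt-↑ˡ m i k | Fin.splitAt-↑ʳ m k j = refl

    extensionBy-KM : ∀ j i → extensionBy g (m ↑ʳ j) (i ↑ˡ k) ≡ false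
    extensionBy-KM j i rewrite Fin.splitAt-↑ʳ m k j | Fin.splitAt-↑ˡ m i k = refl

    extensionBy-KK : ∀ j j' → extensionBy g (m ↑ʳ j) (m ↑ʳ j') ≡ P j j'
    extensionBy-KK j j' rewrite Fin.splitAt-↑ʳ m k j | Fin.splitAt-↑ʳ m k j' = refl

  record IsExtension (R : Rel (m + k)) : Set where
    field
      partialOrder : PartialOrderLaws R
      induces : ∀ j j' → R (m ↑ʳ j) (m ↑ʳ j') ≡ P j j'
      M-minimal : ∀ i → isMinimal R (i ↑ˡ k) ≡ true
      K-nonminimal : ∀ j → isMinimal R (m ↑ʳ j) ≡ false

  module _ (R : Rel (m + k)) where

    private
      inducesᵇ : Bool
      inducesᵇ = allF λ j → allF λ j' → R (m ↑ʳ j) (m ↑ʳ j') ⇔ᵇ P j j'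

      M-minimalᵇ : Bool
      M-minimalᵇ = allF λ i → isMinimal R (i ↑ˡ k)

    isExtension-sound : isExtension m P R ≡ true → IsExtension R
    isExtension-sound ext = record
      { partialOrder = isPartialOrder-sound R (∧-elimˡ ext)
      ; induces = λ j j' → ⇔ᵇ-elim (allF-elim (allF-elim
          {f = λ j → allF λ j' → R (m ↑ʳ j) (m ↑ʳ j') ⇔ᵇ P j j'} (∧-elimˡ rest) j) j')
      ; M-minimal = allF-elim {f = λ i → isMinimal R (i ↑ˡ k)}
          (∧-elimˡ (∧-elimʳ {inducesᵇ} rest))
      ; K-nonminimal = λ j → not-true (allF-elim {f = λ j → not (isMinimal R (m ↑ʳ j))}
          (∧-elimʳ {M-minimalᵇ} (∧-elimʳ {inducesᵇ} rest)) j)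
      }
      where
      rest : (inducesᵇ ∧ (M-minimalᵇ ∧ allF λ j → not (isMinimal R (m ↑ʳ j)))) ≡ true
      rest = ∧-elimʳ {isPartialOrder R} ext

    isExtension-complete : IsExtension R → isExtension m P R ≡ true
    isExtension-complete ext = ∧-intro (isPartialOrder-complete R partialOrder)
      (∧-intro (allF-intro λ j → allF-intro λ j' → ⇔ᵇ-intro (induces j j'))
        (∧-intro (allF-intro M-minimal) (allF-intro λ j → cong not (K-nonminimal j))))
      where open IsExtension ext

  module _ {R : Rel (m + k)} (ext : IsExtension R) where
    open IsExtension ext

    below-M : ∀ i y → R y (i ↑ˡ k) ≡ true → y ≡ i ↑ˡ k
    below-M i = isMinimal-elim R (i ↑ˡ k) (M-minimal i)

    module _ (g : Fin m → Subset k) (g≗ : ∀ i j → upsetsAbove R i j ≡ g i j) where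

      upsetsAbove-isUpset : ∀ i → isUpset P (g i) ≡ true
      upsetsAbove-isUpset i = allF-intro λ x → allF-intro λ y → ⇒ᵇ-intro λ h →
        trans (sym (g≗ i y)) (transitive partialOrder (i ↑ˡ k) (m ↑ʳ x) (m ↑ʳ y)
          (trans (g≗ i x) (∧-elimˡ h)) (trans (induces x y) (∧-elimʳ h)))

      upsetsAbove-covers : ∀ a → isMinimal P a ≡ true → not (uncovered g a) ≡ true
      upsetsAbove-covers a min-a with nonMinimal-elim R (m ↑ʳ a) (K-nonminimal a)
      ... | y , y≤a , y≢a with split m k y
      ...   | inM i = cong not (allF-counterexample i (cong not (trans (sym (g≗ i a)) y≤a)))
      ...   | inK j = ⊥-elim (y≢a (cong (m ↑ʳ_)
                        (isMinimal-elim P a min-a j (trans (sym (induces j a)) y≤a))))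

      upsetsAbove-isUpsetCover : isUpsetCover P g ≡ true
      upsetsAbove-isUpsetCover =
        ∧-intro (allF-intro upsetsAbove-isUpset)
                (allF-intro λ a → ⇒ᵇ-intro (upsetsAbove-covers a))

      extension-determined : ∀ x y → R x y ≡ extensionBy g x y
      extension-determined x y with split m k x | split m k y
      ... | inM i | inM i' = trans (bool-ext
              (λ r → ≟-intro (Fin.↑ˡ-injective k i i' (below-M i' (i ↑ˡ k) r)))
              (λ i≡i' → subst (λ z → R (i ↑ˡ k) (z ↑ˡ k) ≡ true) (≟-elim i≡i')
                          (reflexive partialOrder (i ↑ˡ k))))
            (sym (extensionBy-MM g i i'))
      ... | inM i | inK j = trans (g≗ i j) (sym (extensionBy-MK g i j))
      ... | inK j | inM i = trans (≢true⇒≡false λ r → ↑ˡ≢↑ʳ i j (sym (below-M i (m ↑ʳ j) r)))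
                                  (sym (extensionBy-KM g j i))
      ... | inK j | inK j' = trans (induces j j') (sym (extensionBy-KK g j j'))

  module _ (g : Fin m → Subset k) (cover : isUpsetCover P g ≡ true) where

    upsetCover-upset : ∀ i x y → g i x ≡ true → P x y ≡ true → g i y ≡ true
    upsetCover-upset i x y gix x≤y =
      ⇒ᵇ-elim (allF-elim (allF-elim (allF-elim {f = λ i → isUpset P (g i)} (∧-elimˡ cover) i) x) y)
              (∧-intro gix x≤y)

    upsetCover-covers : ∀ a → isMinimal P a ≡ true → ∃ λ i → g i a ≡ true
    upsetCover-covers a min-a with allF-false (not-true
      (⇒ᵇ-elim (allF-elim (∧-elimʳ {allUpsets P g} cover) a) min-a))
    ... | i , gia = i , not-false gia

    -- The omitted clauses have a hypothesis of type false ≡ true.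
    joinRel-partialOrder : PartialOrderLaws (joinRel g)
    joinRel-partialOrder .reflexive (inj₁ i) = ≟-intro refl
    joinRel-partialOrder .reflexive (inj₂ j) = reflexive poP j
    joinRel-partialOrder .antisym (inj₁ i) (inj₁ i') r _ = cong inj₁ (≟-elim r)
    joinRel-partialOrder .antisym (inj₂ j) (inj₂ j') r s = cong inj₂ (antisym poP j j' r s)
    joinRel-partialOrder .transitive (inj₁ i) (inj₁ i') w r s =
      subst (λ v → joinRel g v w ≡ true) (cong inj₁ (sym (≟-elim r))) s
    joinRel-partialOrder .transitive (inj₁ i) (inj₂ j) (inj₂ j'') r s =
      upsetCover-upset i j j'' r s
    joinRel-partialOrder .transitive (inj₂ j) (inj₂ j') (inj₂ j'') r s =
      transitive poP j j' j'' r s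

    extensionBy-partialOrder : PartialOrderLaws (extensionBy g)
    extensionBy-partialOrder .reflexive x = reflexive joinRel-partialOrder (splitAt m x)
    extensionBy-partialOrder .antisym x y r s =
      trans (sym (Fin.join-splitAt m k x))
        (trans (cong (join m k) (antisym joinRel-partialOrder (splitAt m x) (splitAt m y) r s))
               (Fin.join-splitAt m k y))
    extensionBy-partialOrder .transitive x y z =
      transitive joinRel-partialOrder (splitAt m x) (splitAt m y) (splitAt m z)

    module _ {R : Rel (m + k)} (R≗ : ∀ x y → R x y ≡ extensionBy g x y) where

      extensionBy-M-minimal : ∀ i → isMinimal R (i ↑ˡ k) ≡ true
      extensionBy-M-minimal i = isMinimal-intro R (i ↑ˡ k) below-i
        where
        below-i : ∀ y → R y (i ↑ˡ k) ≡ true → y ≡ i ↑ˡ k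
        below-i y r with split m k y
        ... | inM i' =
          cong (_↑ˡ k) (≟-elim (trans (sym (extensionBy-MM g i' i)) (trans (sym (R≗ _ _)) r)))
        ... | inK j = ⊥-elim (true≢false r (trans (R≗ _ _) (extensionBy-KM g j i)))

      extensionBy-K-nonminimal : ∀ j → isMinimal R (m ↑ʳ j) ≡ false
      extensionBy-K-nonminimal j with minimal-below P poP j
      ... | a , min-a , a≤j with upsetCover-covers a min-a
      ...   | i , gia = nonMinimal-intro R (m ↑ʳ j) (i ↑ˡ k)
                (trans (R≗ _ _) (trans (extensionBy-MK g i j) (upsetCover-upset i a j gia a≤j)))
                (↑ˡ≢↑ʳ i j)

      extensionBy-isExtension : IsExtension R
      extensionBy-isExtension = record
        { partialOrder = partialOrder-resp R≗ extensionBy-partialOrder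
        ; induces = λ j j' → trans (R≗ _ _) (extensionBy-KK g j j')
        ; M-minimal = extensionBy-M-minimal
        ; K-nonminimal = extensionBy-K-nonminimal
        }

  extensions≡upsetCovers : e m P ≡ count (isUpsetCover P) (allFuns m (allSubsets k))
  extensions≡upsetCovers =
    count-bijection relations families (isExtension m P) (isUpsetCover P)
      upsetsAbove extensionBy graph
    where
    relations : Enumeration (Rel (m + k))
    relations = funEnumeration (m + k) (funEnumeration (m + k) boolEnumeration)

    families : Enumeration (Fin m → Subset k)
    families = funEnumeration m (funEnumeration k boolEnumeration)

    pointwise : ∀ {a b} {F G : Fin a → Fin b → Bool} →
      allF (λ x → allF λ y → F x y ⇔ᵇ G x y) ≡ true → ∀ x y → F x y ≡ G x y
    pointwise h x y = ⇔ᵇ-elim (allF-elim (allF-elim h x) y)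

    pointwise⁻ : ∀ {a b} {F G : Fin a → Fin b → Bool} →
      (∀ x y → F x y ≡ G x y) → allF (λ x → allF λ y → F x y ⇔ᵇ G x y) ≡ true
    pointwise⁻ h = allF-intro λ x → allF-intro λ y → ⇔ᵇ-intro (h x y)

    graph : ∀ R g → (isExtension m P R ∧ eqᵇ families (upsetsAbove R) g)
                  ≡ (isUpsetCover P g ∧ eqᵇ relations R (extensionBy g))
    graph R g = bool-ext
      (λ h → let ext = isExtension-sound R (∧-elimˡ h)
                 g≗ = pointwise (∧-elimʳ {isExtension m P R} h) in
        ∧-intro (upsetsAbove-isUpsetCover ext g g≗)
                (pointwise⁻ (extension-determined ext g g≗)))
      (λ h → let cover = ∧-elimˡ h
                 R≗ = pointwise (∧-elimʳ {isUpsetCover P g} h) in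
        ∧-intro (isExtension-complete R (extensionBy-isExtension g cover R≗))
                (pointwise⁻ λ i j → trans (R≗ _ _) (extensionBy-MK g i j)))

-- Upsets avoiding B and downsets of P − B

disjoint : ∀ {k} → Subset k → Subset k → Bool
disjoint U B = allF λ x → B x ⇒ᵇ not (U x)

nor-elim : ∀ {a b} → not (a ∨ b) ≡ true → a ≡ false × b ≡ false
nor-elim {false} {false} _ = refl , refl

nor-intro : ∀ {a b} → a ≡ false → b ≡ false → not (a ∨ b) ≡ true
nor-intro refl refl = refl

nor-involutive : ∀ a b → (b ≡ true → a ≡ false) → not (not (a ∨ b) ∨ b) ≡ a
nor-involutive true true h = sym (h refl)
nor-involutive true false _ = refl
nor-involutive false true _ = refl
nor-involutive false false _ = refl

module _ {k : ℕ} (P : Rel k) (B : Subset k)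
         (B-minimal : ∀ x → B x ≡ true → isMinimal P x ≡ true) where

  complementOutside : Subset k → Subset k
  complementOutside U x = not (U x ∨ B x)

  upsets-disjoint≡downsets :
    count (λ U → isUpset P U ∧ disjoint U B) (allSubsets k) ≡ dMinus P B
  upsets-disjoint≡downsets =
    count-bijection subsets subsets (λ U → isUpset P U ∧ disjoint U B) (isDownsetOn P (compl B))
      complementOutside complementOutside graph
    where
    subsets : Enumeration (Subset k)
    subsets = funEnumeration k boolEnumeration

    graph : ∀ U S → ((isUpset P U ∧ disjoint U B) ∧ eqᵇ subsets (complementOutside U) S)
                  ≡ (isDownsetOn P (compl B) S ∧ eqᵇ subsets U (complementOutside S))
    graph U S = bool-ext to from
      where
      to : ((isUpset P U ∧ disjoint U B) ∧ eqᵇ subsets (complementOutside U) S) ≡ true →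
           (isDownsetOn P (compl B) S ∧ eqᵇ subsets U (complementOutside S)) ≡ true
      to h = ∧-intro
        (∧-intro (allF-intro λ x → ⇒ᵇ-intro λ Sx → cong not (S-outside-B x Sx))
                 (allF-intro λ x → allF-intro λ y → ⇒ᵇ-intro λ c →
                    S-down x y (not-true (∧-elimˡ c)) (∧-elimˡ (∧-elimʳ {not (B x)} c))
                      (∧-elimʳ {S y} (∧-elimʳ {not (B x)} c))))
        (allF-intro λ x → ⇔ᵇ-intro (trans (sym (nor-involutive (U x) (B x) (U-disjoint x)))
                                          (cong (λ s → not (s ∨ B x)) (S≗ x))))
        where
        U-upset : ∀ x y → U x ≡ true → P x y ≡ true → U y ≡ true
        U-upset x y Ux x≤y =
          ⇒ᵇ-elim (allF-elim (allF-elim (∧-elimˡ (∧-elimˡ h)) x) y) (∧-intro Ux x≤y)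

        U-disjoint : ∀ x → B x ≡ true → U x ≡ false
        U-disjoint x Bx =
          not-true (⇒ᵇ-elim (allF-elim (∧-elimʳ {isUpset P U} (∧-elimˡ h)) x) Bx)

        S≗ : ∀ x → complementOutside U x ≡ S x
        S≗ x = ⇔ᵇ-elim (allF-elim (∧-elimʳ {isUpset P U ∧ disjoint U B} h) x)

        S-outside-B : ∀ x → S x ≡ true → B x ≡ false
        S-outside-B x Sx = proj₂ (nor-elim (trans (S≗ x) Sx))

        S-down : ∀ x y → B x ≡ false → S y ≡ true → P x y ≡ true → S x ≡ true
        S-down x y Bx Sy x≤y = trans (sym (S≗ x)) (nor-intro x∉U Bx)
          where
          x∉U : U x ≡ false
          x∉U = ≢true⇒≡false λ Ux →
            true≢false (U-upset x y Ux x≤y) (proj₁ (nor-elim (trans (S≗ y) Sy)))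

      from : (isDownsetOn P (compl B) S ∧ eqᵇ subsets U (complementOutside S)) ≡ true →
             ((isUpset P U ∧ disjoint U B) ∧ eqᵇ subsets (complementOutside U) S) ≡ true
      from h = ∧-intro
        (∧-intro (allF-intro λ x → allF-intro λ y → ⇒ᵇ-intro λ c →
                    U-upset x y (∧-elimˡ c) (∧-elimʳ {U x} c))
                 (allF-intro λ x → ⇒ᵇ-intro λ Bx → cong not (U-disjoint x Bx)))
        (allF-intro λ x → ⇔ᵇ-intro (trans (cong (λ u → not (u ∨ B x)) (U≗ x))
                                          (nor-involutive (S x) (B x) (S-outside-B x))))
        where
        S-outside-B : ∀ x → B x ≡ true → S x ≡ false
        S-outside-B x Bx = ≢true⇒≡false λ Sx → true≢false Bx
          (not-true (⇒ᵇ-elim (allF-elim (∧-elimˡ (∧-elimˡ h)) x) Sx))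

        S-down : ∀ x y → B x ≡ false → S y ≡ true → P x y ≡ true → S x ≡ true
        S-down x y Bx Sy x≤y =
          ⇒ᵇ-elim (allF-elim (allF-elim (∧-elimʳ {S ⊆ᵇ compl B} (∧-elimˡ h)) x) y)
            (∧-intro (cong not Bx) (∧-intro Sy x≤y))

        U≗ : ∀ x → U x ≡ complementOutside S x
        U≗ x = ⇔ᵇ-elim (allF-elim (∧-elimʳ {isDownsetOn P (compl B) S} h) x)

        U-disjoint : ∀ x → B x ≡ true → U x ≡ false
        U-disjoint x Bx =
          trans (U≗ x) (trans (cong (λ b → not (S x ∨ b)) Bx) (cong not (∨-zeroʳ (S x))))

        U-upset : ∀ x y → U x ≡ true → P x y ≡ true → U y ≡ true
        U-upset x y Ux x≤y with nor-elim (trans (sym (U≗ x)) Ux)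
        ... | x∉S , x∉B = trans (U≗ y) (nor-intro
          (≢true⇒≡false λ Sy → true≢false (S-down x y x∉B Sy x≤y) x∉S)
          (≢true⇒≡false λ By → true≢false (subst (λ z → B z ≡ true) (y-is-x By) By) x∉B))
          where
          y-is-x : B y ≡ true → y ≡ x
          y-is-x By = sym (isMinimal-elim P y (B-minimal y By) x x≤y)

-- Counting the covering families

allF-∧ : ∀ {n} (f g : Fin n → Bool) → (allF f ∧ allF g) ≡ allF (λ i → f i ∧ g i)
allF-∧ {zero} f g = refl
allF-∧ {suc n} f g =
  trans (interchange (CommutativeMonoid.commutativeSemigroup ∧-commutativeMonoid)
                     (f zero) (allF λ i → f (suc i)) (g zero) (allF λ i → g (suc i)))
        (cong ((f zero ∧ g zero) ∧_) (allF-∧ (λ i → f (suc i)) (λ i → g (suc i))))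

⊆ᵇ-uncovered : ∀ {m k} (B : Subset k) (g : Fin m → Subset k) →
  (B ⊆ᵇ uncovered g) ≡ allF (λ i → disjoint (g i) B)
⊆ᵇ-uncovered B g = bool-ext
  (λ h → allF-intro {f = λ i → disjoint (g i) B} λ i → allF-intro λ x → ⇒ᵇ-intro λ Bx →
     allF-elim (⇒ᵇ-elim (allF-elim {f = λ x → B x ⇒ᵇ uncovered g x} h x) Bx) i)
  (λ h → allF-intro {f = λ x → B x ⇒ᵇ uncovered g x} λ x → ⇒ᵇ-intro λ Bx → allF-intro λ i →
     ⇒ᵇ-elim (allF-elim (allF-elim {f = λ i → disjoint (g i) B} h i) x) Bx)

upsetFamilies-avoiding : ∀ m {k} (P : Rel k) (B : Subset k) →
  (∀ x → B x ≡ true → isMinimal P x ≡ true) →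
  sumℤ (λ g → 𝟙 (allUpsets P g ∧ (B ⊆ᵇ uncovered g))) (allFuns m (allSubsets k))
    ≡ (+ dMinus P B) ^ℤ m
upsetFamilies-avoiding m {k} P B B-minimal =
  begin
    sumℤ (λ g → 𝟙 (allUpsets P g ∧ (B ⊆ᵇ uncovered g))) (allFuns m (allSubsets k))
  ≡⟨ sumℤ-cong (λ g → cong 𝟙 (trans (cong (allUpsets P g ∧_) (⊆ᵇ-uncovered B g))
                                (allF-∧ (λ i → isUpset P (g i)) (λ i → disjoint (g i) B))))
       (allFuns m (allSubsets k)) ⟩
    sumℤ (λ g → 𝟙 (allF λ i → isUpset P (g i) ∧ disjoint (g i) B)) (allFuns m (allSubsets k))
  ≡⟨ sumℤ-cong (λ g → 𝟙-allF (λ i → isUpset P (g i) ∧ disjoint (g i) B))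
                (allFuns m (allSubsets k)) ⟩
    sumℤ (λ g → prodFin λ i → 𝟙 (isUpset P (g i) ∧ disjoint (g i) B)) (allFuns m (allSubsets k))
  ≡⟨ sumℤ-allFuns-power m (allSubsets k) (λ U → 𝟙 (isUpset P U ∧ disjoint U B)) ⟩
    sumℤ (λ U → 𝟙 (isUpset P U ∧ disjoint U B)) (allSubsets k) ^ℤ m
  ≡⟨ cong (_^ℤ m) (sym (count-sumℤ (λ U → isUpset P U ∧ disjoint U B) (allSubsets k))) ⟩
    (+ count (λ U → isUpset P U ∧ disjoint U B) (allSubsets k)) ^ℤ m
  ≡⟨ cong (λ d → (+ d) ^ℤ m) (upsets-disjoint≡downsets P B B-minimal) ⟩
    (+ dMinus P B) ^ℤ m
  ∎
  where open ≡-Reasoning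

signed-upsetFamilies : ∀ m {k} (P : Rel k) (B : Subset k) →
  sumℤ (λ g → 𝟙 (allUpsets P g) *ℤ
                (if B ⊆ᵇ minimals P then -1ℤ ^ℤ card B *ℤ 𝟙 (B ⊆ᵇ uncovered g) else 0ℤ))
       (allFuns m (allSubsets k))
  ≡ (if B ⊆ᵇ minimals P then -1ℤ ^ℤ card B *ℤ (+ dMinus P B) ^ℤ m else 0ℤ)
signed-upsetFamilies m {k} P B with B ⊆ᵇ minimals P in B⊆A
... | false = trans (sumℤ-cong (λ g → ℤ.*-zeroʳ (𝟙 (allUpsets P g))) families) (sumℤ-zero families)
  where
  families : List (Fin m → Subset k)
  families = allFuns m (allSubsets k)
... | true =
  begin
    sumℤ (λ g → 𝟙 (allUpsets P g) *ℤ (σ *ℤ 𝟙 (B ⊆ᵇ uncovered g))) families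
  ≡⟨ sumℤ-cong (λ g → trans (x∙yz≈y∙xz ℤ.*-commutativeSemigroup (𝟙 (allUpsets P g)) σ _)
                            (cong (σ *ℤ_) (sym (𝟙-∧ (allUpsets P g) _)))) families ⟩
    sumℤ (λ g → σ *ℤ 𝟙 (allUpsets P g ∧ (B ⊆ᵇ uncovered g))) families
  ≡⟨ sumℤ-*ˡ σ _ families ⟩
    σ *ℤ sumℤ (λ g → 𝟙 (allUpsets P g ∧ (B ⊆ᵇ uncovered g))) families
  ≡⟨ cong (σ *ℤ_) (upsetFamilies-avoiding m P B λ x Bx → ⇒ᵇ-elim (allF-elim B⊆A x) Bx) ⟩
    σ *ℤ (+ dMinus P B) ^ℤ m
  ∎
  where
  open ≡-Reasoning
  families : List (Fin m → Subset k)
  families = allFuns m (allSubsets k)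

  σ : ℤ
  σ = -1ℤ ^ℤ card B

theorem4p2 : (k : ℕ) (P : Rel k) → isPartialOrder P ≡ true →
    (m : ℕ) → + (e m P) ≡ rhs m P
theorem4p2 k P isPO m =
  begin
    + e m P
  ≡⟨ cong +_ (Extensions.extensions≡upsetCovers {m} P (isPartialOrder-sound P isPO)) ⟩
    + count (isUpsetCover P) families
  ≡⟨ count-sumℤ (isUpsetCover P) families ⟩
    sumℤ (λ g → 𝟙 (isUpsetCover P g)) families
  ≡⟨ sumℤ-cong (λ g → trans (𝟙-∧ (allUpsets P g) _)
       (cong (𝟙 (allUpsets P g) *ℤ_) (inclusion-exclusion (minimals P) (uncovered g)))) families ⟩
    sumℤ (λ g → 𝟙 (allUpsets P g) *ℤ sumℤ (term g) (allSubsets k)) families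
  ≡⟨ sumℤ-cong (λ g → sym (sumℤ-*ˡ (𝟙 (allUpsets P g)) (term g) (allSubsets k))) families ⟩
    sumℤ (λ g → sumℤ (λ B → 𝟙 (allUpsets P g) *ℤ term g B) (allSubsets k)) families
  ≡⟨ sumℤ-comm (λ g B → 𝟙 (allUpsets P g) *ℤ term g B) families (allSubsets k) ⟩
    sumℤ (λ B → sumℤ (λ g → 𝟙 (allUpsets P g) *ℤ term g B) families) (allSubsets k)
  ≡⟨ sumℤ-cong (signed-upsetFamilies m P) (allSubsets k) ⟩
    rhs m P
  ∎
  where
  open ≡-Reasoning
  families : List (Fin m → Subset k)
  families = allFuns m (allSubsets k)

  term : (Fin m → Subset k) → Subset k → ℤ
  term g B = if B ⊆ᵇ minimals P then -1ℤ ^ℤ card B *ℤ 𝟙 (B ⊆ᵇ uncovered g) else 0ℤ
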